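{- Let $\tau$ be a configuration type not equivalent to $\omega_T$ and $\kappa$ a computation type not equivalent to $\omega_C$, and let $I$ be a finite index set. Then: (1) $\bigwedge_{i\in I}(\delta_i\to\tau_i)\le_D\delta\to\tau$ iff there is a nonempty $J\subseteq I$ with $\delta\le_D\bigwedge_{j\in J}\delta_j$ and $\bigwedge_{j\in J}\tau_j\le_T\tau$; (2) $\bigwedge_{i\in I}(\sigma_i\to\kappa_i)\le_T\sigma\to\kappa$ iff there is a nonempty $J\subseteq I$ with $\sigma\le_S\bigwedge_{j\in J}\sigma_j$ and $\bigwedge_{j\in J}\kappa_j\le_C\kappa$.
   Context: Fix a countably infinite set $\mathbf{L}$ of locations. Value types $\delta ::= \delta\to\tau \mid \delta\wedge\delta \mid \omega_D$; store types $\sigma ::= \langle \ell:\delta\rangle \mid \sigma\wedge\sigma \mid \omega_S$; computation types $\kappa ::= \delta\times\sigma \mid \kappa\wedge\kappa\mid\omega_C$; configuration types $\tau ::= \sigma\to\kappa \mid \tau\wedge\tau \mid \omega_T$ (with preorder $\le_T$). $\bigwedge_{i\in\emptyset}\varphi_i$ denotes $\omega$ of the relevant sort. For each sort $A$, $\le_A$ is the least preorder with $\varphi\le\omega_A$, $\varphi\wedge\psi\le\varphi$, $\varphi\wedge\psi\le\psi$, $\varphi\le\varphi\wedge\varphi$, $\varphi\le\varphi',\psi\le\psi'\Rightarrow\varphi\wedge\psi\le\varphi'\wedge\psi'$, and: $\omega_D\le\omega_D\to\omega_T$; $(\delta\to\tau)\wedge(\delta\to\tau')\le\delta\to(\tau\wedge\tau')$;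 $\langle\ell:\delta\rangle\wedge\langle\ell:\delta'\rangle\le\langle\ell:\delta\wedge\delta'\rangle$; $\omega_C\le\omega_D\times\omega_S$; $(\delta\times\sigma)\wedge(\delta'\times\sigma')\le(\delta\wedge\delta')\times(\sigma\wedge\sigma')$; $\omega_T\le\omega_S\to\omega_C$; $(\sigma\to\kappa)\wedge(\sigma\to\kappa')\le\sigma\to(\kappa\wedge\kappa')$; if $\delta'\le\delta$, $\tau\le\tau'$ then $\delta\to\tau\le\delta'\to\tau'$; if $\sigma'\le\sigma$, $\kappa\le\kappa'$ then $\sigma\to\kappa\le\sigma'\to\kappa'$; $\times$ and $\langle\ell:\cdot\rangle$ covariant. Two types are equivalent if each is $\le$ the other. -}

module Defs where

open import Data.Nat using (ℕ; zero; suc)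
open import Data.Fin using (Fin; zero; suc)
open import Data.Fin.Subset using (Subset; inside; outside)
open import Data.Vec using ([]; _∷_)
open import Data.List using (List; []; _∷_)
open import Data.Product using (_×_)

-- Locations: a fixed countably infinite set, taken to be ℕ.
Loc : Set
Loc = ℕ

infixr 7 _⇒D_ _⇒T_
infixl 6 _∧D_ _∧S_ _∧C_ _∧T_
infix 8 _×C_

mutual
  data ValTy : Set where
    _⇒D_ : ValTy → ConfTy → ValTy
    _∧D_ : ValTy → ValTy → ValTy
    ωD   : ValTy

  data StoTy : Set where
    ⟨_∶_⟩ : Loc → ValTy → StoTy
    _∧S_  : StoTy → StoTy → StoTy
    ωS    : StoTy

  data CompTy : Set where
    _×C_ : ValTy → StoTy → CompTy
    _∧C_ : CompTy → CompTy → CompTy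
    ωC   : CompTy

  data ConfTy : Set where
    _⇒T_ : StoTy → CompTy → ConfTy
    _∧T_ : ConfTy → ConfTy → ConfTy
    ωT   : ConfTy

infix 4 _≤D_ _≤S_ _≤C_ _≤T_

mutual
  data _≤D_ : ValTy → ValTy → Set where
    reflD  : ∀ {a} → a ≤D a
    transD : ∀ {a b c} → a ≤D b → b ≤D c → a ≤D c
    ≤ωD    : ∀ {a} → a ≤D ωD
    ∧≤lD   : ∀ {a b} → a ∧D b ≤D a
    ∧≤rD   : ∀ {a b} → a ∧D b ≤D b
    dupD   : ∀ {a} → a ≤D a ∧D a
    ∧monoD : ∀ {a b a' b'} → a ≤D a' → b ≤D b' → a ∧D b ≤D a' ∧D b'
    ωD≤⇒   : ωD ≤D ωD ⇒D ωT
    ⇒∧D    : ∀ {d t t'} → (d ⇒D t) ∧D (d ⇒D t') ≤D d ⇒D (t ∧T t')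
    ⇒monoD : ∀ {d d' t t'} → d' ≤D d → t ≤T t' → d ⇒D t ≤D d' ⇒D t'

  data _≤S_ : StoTy → StoTy → Set where
    reflS  : ∀ {a} → a ≤S a
    transS : ∀ {a b c} → a ≤S b → b ≤S c → a ≤S c
    ≤ωS    : ∀ {a} → a ≤S ωS
    ∧≤lS   : ∀ {a b} → a ∧S b ≤S a
    ∧≤rS   : ∀ {a b} → a ∧S b ≤S b
    dupS   : ∀ {a} → a ≤S a ∧S a
    ∧monoS : ∀ {a b a' b'} → a ≤S a' → b ≤S b' → a ∧S b ≤S a' ∧S b'
    locS∧  : ∀ {l d d'} → ⟨ l ∶ d ⟩ ∧S ⟨ l ∶ d' ⟩ ≤S ⟨ l ∶ d ∧D d' ⟩
    locMonoS : ∀ {l d d'} → d ≤D d' → ⟨ l ∶ d ⟩ ≤S ⟨ l ∶ d' ⟩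

  data _≤C_ : CompTy → CompTy → Set where
    reflC  : ∀ {a} → a ≤C a
    transC : ∀ {a b c} → a ≤C b → b ≤C c → a ≤C c
    ≤ωC    : ∀ {a} → a ≤C ωC
    ∧≤lC   : ∀ {a b} → a ∧C b ≤C a
    ∧≤rC   : ∀ {a b} → a ∧C b ≤C b
    dupC   : ∀ {a} → a ≤C a ∧C a
    ∧monoC : ∀ {a b a' b'} → a ≤C a' → b ≤C b' → a ∧C b ≤C a' ∧C b'
    ωC≤×   : ωC ≤C ωD ×C ωS
    ×∧C    : ∀ {d s d' s'} → (d ×C s) ∧C (d' ×C s') ≤C (d ∧D d') ×C (s ∧S s')
    ×monoC : ∀ {d d' s s'} → d ≤D d' → s ≤S s' → d ×C s ≤C d' ×C s'

  data _≤T_ : ConfTy → ConfTy → Set where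
    reflT  : ∀ {a} → a ≤T a
    transT : ∀ {a b c} → a ≤T b → b ≤T c → a ≤T c
    ≤ωT    : ∀ {a} → a ≤T ωT
    ∧≤lT   : ∀ {a b} → a ∧T b ≤T a
    ∧≤rT   : ∀ {a b} → a ∧T b ≤T b
    dupT   : ∀ {a} → a ≤T a ∧T a
    ∧monoT : ∀ {a b a' b'} → a ≤T a' → b ≤T b' → a ∧T b ≤T a' ∧T b'
    ωT≤⇒   : ωT ≤T ωS ⇒T ωC
    ⇒∧T    : ∀ {s k k'} → (s ⇒T k) ∧T (s ⇒T k') ≤T s ⇒T (k ∧C k')
    ⇒monoT : ∀ {s s' k k'} → s' ≤S s → k ≤C k' → s ⇒T k ≤T s' ⇒T k'

_≃T_ : ConfTy → ConfTy → Set
a ≃T b = (a ≤T b) × (b ≤T a)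

_≃C_ : CompTy → CompTy → Set
a ≃C b = (a ≤C b) × (b ≤C a)

bigWedge : {A : Set} → (A → A → A) → A → List A → A
bigWedge _∧_ ω []           = ω
bigWedge _∧_ ω (x ∷ [])     = x
bigWedge _∧_ ω (x ∷ y ∷ xs) = x ∧ bigWedge _∧_ ω (y ∷ xs)

select : {A : Set} {n : ℕ} → Subset n → (Fin n → A) → List A
select {n = zero}  []             f = []
select {n = suc n} (inside ∷ J)  f = f zero ∷ select J (λ i → f (suc i))
select {n = suc n} (outside ∷ J) f = select J (λ i → f (suc i))

⋀D : {n : ℕ} → Subset n → (Fin n → ValTy) → ValTy
⋀D J f = bigWedge _∧D_ ωD (select J f)

⋀S : {n : ℕ} → Subset n → (Fin n → StoTy) → StoTy
⋀S J f = bigWedge _∧S_ ωS (select J f)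

⋀C : {n : ℕ} → Subset n → (Fin n → CompTy) → CompTy
⋀C J f = bigWedge _∧C_ ωC (select J f)

⋀T : {n : ℕ} → Subset n → (Fin n → ConfTy) → ConfTy
⋀T J f = bigWedge _∧T_ ωT (select J f)

{-# OPTIONS --safe #-}
-- Both parts are one argument about intersections of arrows d ⇒ c. Say that a refines b when
-- each top-level arrow d ⇒ c of b is covered by a finite family T of top-level arrows of a,
-- meaning d ≤ ⋀ dom T and ⋀ cod T ≤ c. Refinement is closed under every rule of the preorder
-- (for transitivity, covers compose), so a ≤ b implies it. For b = δ ⇒ τ this yields the
-- subfamily J, which is nonempty since an empty one would give ω ≤ τ. Conversely,
-- ⋀ (δⱼ ⇒ τⱼ) ≤ ⋀ δⱼ ⇒ ⋀ τⱼ by the rule (δ ⇒ τ) ∧ (δ ⇒ τ') ≤ δ ⇒ (τ ∧ τ').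
module Submission where

open import Defs
open import Data.Nat using (ℕ)
open import Data.Fin using (Fin; zero; suc)
open import Data.Fin.Subset using (Subset; ⊤; Nonempty; inside; outside; ⁅_⁆; _∪_)
  renaming (_∈_ to _∈ₛ_; _⊆_ to _⊆ₛ_; ⊥ to ∅)
open import Data.Fin.Subset.Properties using (∈⊤; ∉⊥; x∈⁅x⁆; x∈⁅y⁆⇒x≡y; x∈p∪q⁻; p⊆p∪q; q⊆p∪q)
open import Data.Vec as Vec using ([]; _∷_)
open import Data.List using (List; []; _∷_; _++_; map)
open import Data.List.Properties using (map-++)
open import Data.List.Relation.Unary.Any using (here; there)
open import Data.List.Membership.Propositional using (_∈_)
open import Data.List.Membership.Propositional.Properties using (∈-++⁻)
open import Data.List.Relation.Binary.Subset.Propositional using (_⊆_)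
open import Data.List.Relation.Binary.Subset.Propositional.Properties using (map⁺; xs⊆xs++ys; xs⊆ys++xs)
open import Data.Product using (_×_; Σ; ∃; _,_; proj₁; proj₂)
open import Data.Sum using (_⊎_; inj₁; inj₂; [_,_]′)
open import Data.Empty using (⊥-elim)
open import Relation.Nullary using (¬_)
open import Relation.Binary.Bundles using (Preorder)
open import Relation.Binary.PropositionalEquality using (_≡_; refl; sym; cong; cong₂; subst; isEquivalence)
open import Function.Bundles using (_⇔_; mk⇔)

module _ {X : Set} where

  select-∈⁻ : ∀ {n} (J : Subset n) (f : Fin n → X) {y} → y ∈ select J f →
              ∃ λ i → i ∈ₛ J × y ≡ f i
  select-∈⁻ (inside ∷ J) f (here refl) = zero , Vec.here , refl
  select-∈⁻ (inside ∷ J) f (there y∈) with select-∈⁻ J (λ i → f (suc i)) y∈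
  ... | i , i∈J , refl = suc i , Vec.there i∈J , refl
  select-∈⁻ (outside ∷ J) f y∈ with select-∈⁻ J (λ i → f (suc i)) y∈
  ... | i , i∈J , refl = suc i , Vec.there i∈J , refl

  select-∈⁺ : ∀ {n} (J : Subset n) (f : Fin n → X) {i} → i ∈ₛ J → f i ∈ select J f
  select-∈⁺ (inside ∷ J)  f Vec.here        = here refl
  select-∈⁺ (inside ∷ J)  f (Vec.there i∈J) = there (select-∈⁺ J (λ i → f (suc i)) i∈J)
  select-∈⁺ (outside ∷ J) f (Vec.there i∈J) = select-∈⁺ J (λ i → f (suc i)) i∈J

  select-mono : ∀ {n} {J K : Subset n} (f : Fin n → X) → J ⊆ₛ K → select J f ⊆ select K f
  select-mono {J = J} {K} f J⊆K y∈ with select-∈⁻ J f y∈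
  ... | i , i∈J , refl = select-∈⁺ K f (J⊆K i∈J)

  select-map : ∀ {Y : Set} {n} (J : Subset n) (f : Fin n → X) (h : X → Y) →
               select J (λ i → h (f i)) ≡ map h (select J f)
  select-map []            f h = refl
  select-map (inside ∷ J)  f h = cong (h (f zero) ∷_) (select-map J (λ i → f (suc i)) h)
  select-map (outside ∷ J) f h = select-map J (λ i → f (suc i)) h

  select-nonempty : ∀ {n} (J : Subset n) (f : Fin n → X) {y} → y ∈ select J f → Nonempty J
  select-nonempty J f y∈ with select-∈⁻ J f y∈
  ... | i , i∈J , _ = i , i∈J

  ⊆select⊤⇒selectable : ∀ {n} (f : Fin n → X) (T : List X) → T ⊆ select ⊤ f →
                        ∃ λ J → select J f ⊆ T × T ⊆ select J f
  ⊆select⊤⇒selectable f [] _ = ∅ , (λ y∈ → ⊥-elim (∉⊥ (proj₂ (select-nonempty ∅ f y∈)))) , λ ()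
  ⊆select⊤⇒selectable f (q ∷ T) q∷T⊆ with select-∈⁻ ⊤ f (q∷T⊆ (here refl))
                                         | ⊆select⊤⇒selectable f T (λ y∈ → q∷T⊆ (there y∈))
  ... | i , _ , refl | J , J⊆T , T⊆J = ⁅ i ⁆ ∪ J , sub , sup
    where
    sub : select (⁅ i ⁆ ∪ J) f ⊆ f i ∷ T
    sub y∈ with select-∈⁻ (⁅ i ⁆ ∪ J) f y∈
    ... | k , k∈ , refl with x∈p∪q⁻ ⁅ i ⁆ J k∈
    ...   | inj₁ k∈i rewrite x∈⁅y⁆⇒x≡y i k∈i = here refl
    ...   | inj₂ k∈J = there (J⊆T (select-∈⁺ J f k∈J))
    sup : f i ∷ T ⊆ select (⁅ i ⁆ ∪ J) f
    sup (here refl) = select-∈⁺ (⁅ i ⁆ ∪ J) f (p⊆p∪q J (x∈⁅x⁆ i))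
    sup (there y∈)  = select-mono f (q⊆p∪q ⁅ i ⁆ J) (T⊆J y∈)

record WedgePreorder : Set₁ where
  infix  4 _≤_
  infixl 6 _∧_
  field
    Carrier  : Set
    _≤_      : Carrier → Carrier → Set
    _∧_      : Carrier → Carrier → Carrier
    ω        : Carrier
    ≤-refl   : ∀ {a} → a ≤ a
    ≤-trans  : ∀ {a b c} → a ≤ b → b ≤ c → a ≤ c
    ≤ω       : ∀ {a} → a ≤ ω
    ∧≤ˡ      : ∀ {a b} → a ∧ b ≤ a
    ∧≤ʳ      : ∀ {a b} → a ∧ b ≤ b
    ≤∧-diag  : ∀ {a} → a ≤ a ∧ a
    ∧-mono   : ∀ {a b a' b'} → a ≤ a' → b ≤ b' → a ∧ b ≤ a' ∧ b'

  ⋀ : List Carrier → Carrier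
  ⋀ = bigWedge _∧_ ω

  preorder : Preorder _ _ _
  preorder = record
    { _≈_ = _≡_ ; _≲_ = _≤_
    ; isPreorder = record
      { isEquivalence = isEquivalence ; reflexive = λ { refl → ≤-refl } ; trans = ≤-trans } }

  ∧-greatest : ∀ {a b c} → a ≤ b → a ≤ c → a ≤ b ∧ c
  ∧-greatest a≤b a≤c = ≤-trans ≤∧-diag (∧-mono a≤b a≤c)

  ⋀-lowerBound : ∀ {x xs} → x ∈ xs → ⋀ xs ≤ x
  ⋀-lowerBound {xs = _ ∷ []}     (here refl) = ≤-refl
  ⋀-lowerBound {xs = _ ∷ _ ∷ _}  (here refl) = ∧≤ˡ
  ⋀-lowerBound {xs = _ ∷ _ ∷ _}  (there x∈)  = ≤-trans ∧≤ʳ (⋀-lowerBound x∈)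

  ⋀-greatest : ∀ {z} ys → (∀ {y} → y ∈ ys → z ≤ y) → z ≤ ⋀ ys
  ⋀-greatest []            _  = ≤ω
  ⋀-greatest (y ∷ [])      z≤ = z≤ (here refl)
  ⋀-greatest (y ∷ y' ∷ ys) z≤ =
    ∧-greatest (z≤ (here refl)) (⋀-greatest (y' ∷ ys) (λ y∈ → z≤ (there y∈)))

  ⋀-antitone : ∀ {xs} ys → ys ⊆ xs → ⋀ xs ≤ ⋀ ys
  ⋀-antitone ys ys⊆xs = ⋀-greatest ys (λ y∈ → ⋀-lowerBound (ys⊆xs y∈))

  ⋀-++⁺ : ∀ xs ys → ⋀ xs ∧ ⋀ ys ≤ ⋀ (xs ++ ys)
  ⋀-++⁺ xs ys = ⋀-greatest (xs ++ ys) λ y∈ → bound (∈-++⁻ xs y∈)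
    where
    bound : ∀ {y} → y ∈ xs ⊎ y ∈ ys → ⋀ xs ∧ ⋀ ys ≤ y
    bound (inj₁ y∈) = ≤-trans ∧≤ˡ (⋀-lowerBound y∈)
    bound (inj₂ y∈) = ≤-trans ∧≤ʳ (⋀-lowerBound y∈)

  ⋀-++⁻ : ∀ xs ys → ⋀ (xs ++ ys) ≤ ⋀ xs ∧ ⋀ ys
  ⋀-++⁻ xs ys = ∧-greatest (⋀-antitone xs (xs⊆xs++ys xs ys)) (⋀-antitone ys (xs⊆ys++xs ys xs))

  ⋀≤-nonTop⇒∃∈ : ∀ {c} xs → ⋀ xs ≤ c → ¬ (ω ≤ c) → ∃ λ x → x ∈ xs
  ⋀≤-nonTop⇒∃∈ []      ω≤c ω≰c = ⊥-elim (ω≰c ω≤c)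
  ⋀≤-nonTop⇒∃∈ (x ∷ _) _   _   = x , here refl

-- What value types and configuration types have in common; p ∈⇒ a says that the arrow p
-- is one of the top-level conjuncts of a.
record ArrowSort : Set₁ where
  field
    Dom Cod Arr : WedgePreorder
  module D = WedgePreorder Dom
  module C = WedgePreorder Cod
  module A = WedgePreorder Arr

  Pair : Set
  Pair = D.Carrier × C.Carrier

  infixr 7 _⇒_
  infix  4 _∈⇒_
  field
    _⇒_     : D.Carrier → C.Carrier → A.Carrier
    ω≤ω⇒ω   : A.ω A.≤ D.ω ⇒ C.ω
    ⇒-∧     : ∀ {d c c'} → (d ⇒ c) A.∧ (d ⇒ c') A.≤ d ⇒ (c C.∧ c')
    ⇒-mono  : ∀ {d d' c c'} → d' D.≤ d → c C.≤ c' → d ⇒ c A.≤ d' ⇒ c'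
    _∈⇒_    : Pair → A.Carrier → Set
    ⇒∈⇒     : ∀ {d c} → (d , c) ∈⇒ d ⇒ c
    ⇒∈⇒⁻    : ∀ {p d c} → p ∈⇒ d ⇒ c → p ≡ (d , c)
    ∧∈⇒ˡ    : ∀ {p a b} → p ∈⇒ a → p ∈⇒ a A.∧ b
    ∧∈⇒ʳ    : ∀ {p a b} → p ∈⇒ b → p ∈⇒ a A.∧ b
    ∧∈⇒⁻    : ∀ {p a b} → p ∈⇒ a A.∧ b → p ∈⇒ a ⊎ p ∈⇒ b
    ω∉⇒     : ∀ {p} → ¬ (p ∈⇒ A.ω)

module ArrowSortProperties (S : ArrowSort) where
  open ArrowSort S

  arrow : Pair → A.Carrier
  arrow (d , c) = d ⇒ c

  dom : List Pair → List D.Carrier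
  dom = map proj₁

  cod : List Pair → List C.Carrier
  cod = map proj₂

  ⋀-arrows≤ : ∀ ps → A.⋀ (map arrow ps) A.≤ D.⋀ (dom ps) ⇒ C.⋀ (cod ps)
  ⋀-arrows≤ []       = ω≤ω⇒ω
  ⋀-arrows≤ (_ ∷ []) = A.≤-refl
  ⋀-arrows≤ (_ ∷ ps@(_ ∷ _)) =
    A.≤-trans (A.∧-mono (⇒-mono D.∧≤ˡ C.≤-refl) (A.≤-trans (⋀-arrows≤ ps) (⇒-mono D.∧≤ʳ C.≤-refl))) ⇒-∧

  ∈⇒⋀-arrows : ∀ ps {p} → p ∈⇒ A.⋀ (map arrow ps) → p ∈ ps
  ∈⇒⋀-arrows []           p∈ = ⊥-elim (ω∉⇒ p∈)
  ∈⇒⋀-arrows (_ ∷ [])     p∈ = here (⇒∈⇒⁻ p∈)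
  ∈⇒⋀-arrows (q ∷ q' ∷ ps) p∈ =
    [ (λ p∈q → here (⇒∈⇒⁻ p∈q)) , (λ p∈qs → there (∈⇒⋀-arrows (q' ∷ ps) p∈qs)) ]′ (∧∈⇒⁻ p∈)

  -- T ≼ S guarantees that the arrows of T together lie below the single arrow ⋀ dom S ⇒ ⋀ cod S.
  infix 4 _≼_ _⊑_
  record _≼_ (T S : List Pair) : Set where
    eta-equality
    constructor mk≼
    field
      dom-≥ : D.⋀ (dom S) D.≤ D.⋀ (dom T)
      cod-≤ : C.⋀ (cod T) C.≤ C.⋀ (cod S)

  ≼-refl : ∀ {S} → S ≼ S
  ≼-refl = mk≼ D.≤-refl C.≤-refl

  ≼-trans : ∀ {U T S} → U ≼ T → T ≼ S → U ≼ S
  ≼-trans (mk≼ d₁ c₁) (mk≼ d₂ c₂) = mk≼ (D.≤-trans d₂ d₁) (C.≤-trans c₁ c₂)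

  ≼-of-⊆⊇ : ∀ {T S} → T ⊆ S → S ⊆ T → T ≼ S
  ≼-of-⊆⊇ {T} {S} T⊆S S⊆T =
    mk≼ (D.⋀-antitone (dom T) (map⁺ proj₁ T⊆S)) (C.⋀-antitone (cod S) (map⁺ proj₂ S⊆T))

  ≼-++ : ∀ {T₁ T₂ S₁ S₂} → T₁ ≼ S₁ → T₂ ≼ S₂ → T₁ ++ T₂ ≼ S₁ ++ S₂
  ≼-++ {T₁} {T₂} {S₁} {S₂} (mk≼ d₁ c₁) (mk≼ d₂ c₂) = mk≼ dom≤ cod≤
    where
    dom≤ : D.⋀ (dom (S₁ ++ S₂)) D.≤ D.⋀ (dom (T₁ ++ T₂))
    dom≤ = begin
      D.⋀ (dom (S₁ ++ S₂))                ≡⟨ cong D.⋀ (map-++ proj₁ S₁ S₂) ⟩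
      D.⋀ (dom S₁ ++ dom S₂)              ≲⟨ D.⋀-++⁻ (dom S₁) (dom S₂) ⟩
      D.⋀ (dom S₁) D.∧ D.⋀ (dom S₂)       ≲⟨ D.∧-mono d₁ d₂ ⟩
      D.⋀ (dom T₁) D.∧ D.⋀ (dom T₂)       ≲⟨ D.⋀-++⁺ (dom T₁) (dom T₂) ⟩
      D.⋀ (dom T₁ ++ dom T₂)              ≡⟨ cong D.⋀ (sym (map-++ proj₁ T₁ T₂)) ⟩
      D.⋀ (dom (T₁ ++ T₂))                ∎
      where open import Relation.Binary.Reasoning.Preorder D.preorder
    cod≤ : C.⋀ (cod (T₁ ++ T₂)) C.≤ C.⋀ (cod (S₁ ++ S₂))
    cod≤ = begin
      C.⋀ (cod (T₁ ++ T₂))                ≡⟨ cong C.⋀ (map-++ proj₂ T₁ T₂) ⟩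
      C.⋀ (cod T₁ ++ cod T₂)              ≲⟨ C.⋀-++⁻ (cod T₁) (cod T₂) ⟩
      C.⋀ (cod T₁) C.∧ C.⋀ (cod T₂)       ≲⟨ C.∧-mono c₁ c₂ ⟩
      C.⋀ (cod S₁) C.∧ C.⋀ (cod S₂)       ≲⟨ C.⋀-++⁺ (cod S₁) (cod S₂) ⟩
      C.⋀ (cod S₁ ++ cod S₂)              ≡⟨ cong C.⋀ (sym (map-++ proj₂ S₁ S₂)) ⟩
      C.⋀ (cod (S₁ ++ S₂))                ∎
      where open import Relation.Binary.Reasoning.Preorder C.preorder

  Refines : A.Carrier → List Pair → Set
  Refines a S = ∃ λ T → (∀ {p} → p ∈ T → p ∈⇒ a) × T ≼ S

  -- No arrow of b has to be excluded: one with top codomain is refined by the empty family.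
  _⊑_ : A.Carrier → A.Carrier → Set
  a ⊑ b = ∀ {p} → p ∈⇒ b → Refines a (p ∷ [])

  ⊑-refines : ∀ {a b} → a ⊑ b → ∀ S → (∀ {p} → p ∈ S → p ∈⇒ b) → Refines a S
  ⊑-refines a⊑b []      _   = [] , (λ ()) , ≼-refl
  ⊑-refines a⊑b (p ∷ S) S∈b with a⊑b (S∈b (here refl)) | ⊑-refines a⊑b S (λ q∈ → S∈b (there q∈))
  ... | T₁ , T₁∈a , T₁≼p | T₂ , T₂∈a , T₂≼S =
    T₁ ++ T₂ , (λ q∈ → [ T₁∈a , T₂∈a ]′ (∈-++⁻ T₁ q∈)) , ≼-++ T₁≼p T₂≼S

  ⊑-of-⊇ : ∀ {a b} → (∀ {p} → p ∈⇒ b → p ∈⇒ a) → a ⊑ b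
  ⊑-of-⊇ b⊆a p∈b = _ ∷ [] , (λ { (here refl) → b⊆a p∈b }) , ≼-refl

  ⊑-refl : ∀ {a} → a ⊑ a
  ⊑-refl = ⊑-of-⊇ (λ p∈ → p∈)

  ⊑-trans : ∀ {a b c} → a ⊑ b → b ⊑ c → a ⊑ c
  ⊑-trans a⊑b b⊑c p∈c with b⊑c p∈c
  ... | S , S∈b , S≼p with ⊑-refines a⊑b S S∈b
  ... | T , T∈a , T≼S = T , T∈a , ≼-trans T≼S S≼p

  ⊑-ω : ∀ {a} → a ⊑ A.ω
  ⊑-ω = ⊑-of-⊇ (λ p∈ω → ⊥-elim (ω∉⇒ p∈ω))

  ∧-⊑ˡ : ∀ {a b} → a A.∧ b ⊑ a
  ∧-⊑ˡ = ⊑-of-⊇ ∧∈⇒ˡ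

  ∧-⊑ʳ : ∀ {a b} → a A.∧ b ⊑ b
  ∧-⊑ʳ = ⊑-of-⊇ ∧∈⇒ʳ

  ⊑-∧-diag : ∀ {a} → a ⊑ a A.∧ a
  ⊑-∧-diag = ⊑-of-⊇ (λ p∈ → [ (λ p∈a → p∈a) , (λ p∈a → p∈a) ]′ (∧∈⇒⁻ p∈))

  ∧-mono-⊑ : ∀ {a b a' b'} → a ⊑ a' → b ⊑ b' → a A.∧ b ⊑ a' A.∧ b'
  ∧-mono-⊑ {a} {b} a⊑a' b⊑b' p∈ =
    [ (λ p∈a' → widen ∧∈⇒ˡ (a⊑a' p∈a')) , (λ p∈b' → widen ∧∈⇒ʳ (b⊑b' p∈b')) ]′ (∧∈⇒⁻ p∈)
    where
    widen : ∀ {x S} → (∀ {p} → p ∈⇒ x → p ∈⇒ a A.∧ b) → Refines x S → Refines (a A.∧ b) S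
    widen x⊆ab (T , T∈x , T≼S) = T , (λ q∈ → x⊆ab (T∈x q∈)) , T≼S

  ω-⊑-ω⇒ω : A.ω ⊑ D.ω ⇒ C.ω
  ω-⊑-ω⇒ω p∈ rewrite ⇒∈⇒⁻ p∈ = [] , (λ ()) , mk≼ D.≤-refl C.≤-refl

  ⇒-∧-⊑ : ∀ {d c c'} → (d ⇒ c) A.∧ (d ⇒ c') ⊑ d ⇒ (c C.∧ c')
  ⇒-∧-⊑ {d} {c} {c'} p∈ rewrite ⇒∈⇒⁻ p∈ =
    (d , c) ∷ (d , c') ∷ [] ,
    (λ { (here refl) → ∧∈⇒ˡ ⇒∈⇒ ; (there (here refl)) → ∧∈⇒ʳ ⇒∈⇒ }) ,
    mk≼ D.≤∧-diag C.≤-refl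

  ⇒-mono-⊑ : ∀ {d d' c c'} → d' D.≤ d → c C.≤ c' → d ⇒ c ⊑ d' ⇒ c'
  ⇒-mono-⊑ {d} {c = c} d'≤d c≤c' p∈ rewrite ⇒∈⇒⁻ p∈ =
    (d , c) ∷ [] , (λ { (here refl) → ⇒∈⇒ }) , mk≼ d'≤d c≤c'

  ⋀-arrows≤arrow⇔ : (∀ {a b} → a A.≤ b → a ⊑ b) → ∀ {c} → ¬ (C.ω C.≤ c) →
    (n : ℕ) (ds : Fin n → D.Carrier) (cs : Fin n → C.Carrier) (d : D.Carrier) →
    A.⋀ (select ⊤ (λ i → ds i ⇒ cs i)) A.≤ d ⇒ c
      ⇔ Σ (Subset n) (λ J → Nonempty J × d D.≤ D.⋀ (select J ds) × C.⋀ (select J cs) C.≤ c)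
  ⋀-arrows≤arrow⇔ ≤⇒⊑ {c} ω≰c n ds cs d = mk⇔ sound complete
    where
    Witness : Subset n → Set
    Witness J = Nonempty J × d D.≤ D.⋀ (select J ds) × C.⋀ (select J cs) C.≤ c

    pair : Fin n → Pair
    pair i = ds i , cs i

    arrows : Fin n → A.Carrier
    arrows i = ds i ⇒ cs i

    ∈⇒⋀-select : ∀ J {p} → p ∈⇒ A.⋀ (select J arrows) → p ∈ select J pair
    ∈⇒⋀-select J rewrite select-map J pair arrow = ∈⇒⋀-arrows (select J pair)

    sound : A.⋀ (select ⊤ arrows) A.≤ d ⇒ c → Σ (Subset n) Witness
    sound h with ≤⇒⊑ h ⇒∈⇒
    ... | T , T∈ , T≼dc with ⊆select⊤⇒selectable pair T (λ p∈ → ∈⇒⋀-select ⊤ (T∈ p∈))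
    ... | J , J⊆T , T⊆J with ≼-trans (≼-of-⊆⊇ J⊆T T⊆J) T≼dc
    ... | mk≼ d≤ ≤c = J , nonempty , d≤′ , ≤c′
      where
      d≤′ : d D.≤ D.⋀ (select J ds)
      d≤′ = subst (λ xs → d D.≤ D.⋀ xs) (sym (select-map J pair proj₁)) d≤
      ≤c′ : C.⋀ (select J cs) C.≤ c
      ≤c′ = subst (λ xs → C.⋀ xs C.≤ c) (sym (select-map J pair proj₂)) ≤c
      nonempty : Nonempty J
      nonempty = select-nonempty J cs (proj₂ (C.⋀≤-nonTop⇒∃∈ (select J cs) ≤c′ ω≰c))

    complete : Σ (Subset n) Witness → A.⋀ (select ⊤ arrows) A.≤ d ⇒ c
    complete (J , _ , d≤ , ≤c) = begin
      A.⋀ (select ⊤ arrows)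
        ≲⟨ A.⋀-antitone (select J arrows) (select-mono arrows (λ _ → ∈⊤)) ⟩
      A.⋀ (select J arrows)
        ≡⟨ cong A.⋀ (select-map J pair arrow) ⟩
      A.⋀ (map arrow (select J pair))
        ≲⟨ ⋀-arrows≤ (select J pair) ⟩
      D.⋀ (dom (select J pair)) ⇒ C.⋀ (cod (select J pair))
        ≡⟨ cong₂ (λ xs ys → D.⋀ xs ⇒ C.⋀ ys) (sym (select-map J pair proj₁)) (sym (select-map J pair proj₂)) ⟩
      D.⋀ (select J ds) ⇒ C.⋀ (select J cs)
        ≲⟨ ⇒-mono d≤ ≤c ⟩
      d ⇒ c ∎
      where open import Relation.Binary.Reasoning.Preorder A.preorder

valuePreorder : WedgePreorder
valuePreorder = record
  { Carrier = ValTy ; _≤_ = _≤D_ ; _∧_ = _∧D_ ; ω = ωD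
  ; ≤-refl = reflD ; ≤-trans = transD ; ≤ω = ≤ωD ; ∧≤ˡ = ∧≤lD ; ∧≤ʳ = ∧≤rD ; ≤∧-diag = dupD ; ∧-mono = ∧monoD }

storePreorder : WedgePreorder
storePreorder = record
  { Carrier = StoTy ; _≤_ = _≤S_ ; _∧_ = _∧S_ ; ω = ωS
  ; ≤-refl = reflS ; ≤-trans = transS ; ≤ω = ≤ωS ; ∧≤ˡ = ∧≤lS ; ∧≤ʳ = ∧≤rS ; ≤∧-diag = dupS ; ∧-mono = ∧monoS }

computationPreorder : WedgePreorder
computationPreorder = record
  { Carrier = CompTy ; _≤_ = _≤C_ ; _∧_ = _∧C_ ; ω = ωC
  ; ≤-refl = reflC ; ≤-trans = transC ; ≤ω = ≤ωC ; ∧≤ˡ = ∧≤lC ; ∧≤ʳ = ∧≤rC ; ≤∧-diag = dupC ; ∧-mono = ∧monoC }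

configurationPreorder : WedgePreorder
configurationPreorder = record
  { Carrier = ConfTy ; _≤_ = _≤T_ ; _∧_ = _∧T_ ; ω = ωT
  ; ≤-refl = reflT ; ≤-trans = transT ; ≤ω = ≤ωT ; ∧≤ˡ = ∧≤lT ; ∧≤ʳ = ∧≤rT ; ≤∧-diag = dupT ; ∧-mono = ∧monoT }

infix 4 _∈⇒D_ _∈⇒T_

data _∈⇒D_ : ValTy × ConfTy → ValTy → Set where
  ⇒-arrow  : ∀ {δ τ} → (δ , τ) ∈⇒D δ ⇒D τ
  ∧-arrowˡ : ∀ {p a b} → p ∈⇒D a → p ∈⇒D a ∧D b
  ∧-arrowʳ : ∀ {p a b} → p ∈⇒D b → p ∈⇒D a ∧D b

data _∈⇒T_ : StoTy × CompTy → ConfTy → Set where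
  ⇒-arrow  : ∀ {σ κ} → (σ , κ) ∈⇒T σ ⇒T κ
  ∧-arrowˡ : ∀ {p a b} → p ∈⇒T a → p ∈⇒T a ∧T b
  ∧-arrowʳ : ∀ {p a b} → p ∈⇒T b → p ∈⇒T a ∧T b

valueArrows : ArrowSort
valueArrows = record
  { Dom = valuePreorder ; Cod = configurationPreorder ; Arr = valuePreorder
  ; _⇒_ = _⇒D_ ; ω≤ω⇒ω = ωD≤⇒ ; ⇒-∧ = ⇒∧D ; ⇒-mono = ⇒monoD
  ; _∈⇒_ = _∈⇒D_ ; ⇒∈⇒ = ⇒-arrow ; ⇒∈⇒⁻ = λ { ⇒-arrow → refl }
  ; ∧∈⇒ˡ = ∧-arrowˡ ; ∧∈⇒ʳ = ∧-arrowʳ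
  ; ∧∈⇒⁻ = λ { (∧-arrowˡ p∈) → inj₁ p∈ ; (∧-arrowʳ p∈) → inj₂ p∈ } ; ω∉⇒ = λ () }

configurationArrows : ArrowSort
configurationArrows = record
  { Dom = storePreorder ; Cod = computationPreorder ; Arr = configurationPreorder
  ; _⇒_ = _⇒T_ ; ω≤ω⇒ω = ωT≤⇒ ; ⇒-∧ = ⇒∧T ; ⇒-mono = ⇒monoT
  ; _∈⇒_ = _∈⇒T_ ; ⇒∈⇒ = ⇒-arrow ; ⇒∈⇒⁻ = λ { ⇒-arrow → refl }
  ; ∧∈⇒ˡ = ∧-arrowˡ ; ∧∈⇒ʳ = ∧-arrowʳ
  ; ∧∈⇒⁻ = λ { (∧-arrowˡ p∈) → inj₁ p∈ ; (∧-arrowʳ p∈) → inj₂ p∈ } ; ω∉⇒ = λ () }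

module Val = ArrowSortProperties valueArrows
module Conf = ArrowSortProperties configurationArrows

≤D⇒⊑ : ∀ {a b} → a ≤D b → a Val.⊑ b
≤D⇒⊑ reflD           = Val.⊑-refl
≤D⇒⊑ (transD p q)    = Val.⊑-trans (≤D⇒⊑ p) (≤D⇒⊑ q)
≤D⇒⊑ ≤ωD             = Val.⊑-ω
≤D⇒⊑ ∧≤lD            = Val.∧-⊑ˡ
≤D⇒⊑ ∧≤rD            = Val.∧-⊑ʳ
≤D⇒⊑ dupD            = Val.⊑-∧-diag
≤D⇒⊑ (∧monoD p q)    = Val.∧-mono-⊑ (≤D⇒⊑ p) (≤D⇒⊑ q)
≤D⇒⊑ ωD≤⇒            = Val.ω-⊑-ω⇒ω
≤D⇒⊑ ⇒∧D             = Val.⇒-∧-⊑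
≤D⇒⊑ (⇒monoD p q)    = Val.⇒-mono-⊑ p q

≤T⇒⊑ : ∀ {a b} → a ≤T b → a Conf.⊑ b
≤T⇒⊑ reflT           = Conf.⊑-refl
≤T⇒⊑ (transT p q)    = Conf.⊑-trans (≤T⇒⊑ p) (≤T⇒⊑ q)
≤T⇒⊑ ≤ωT             = Conf.⊑-ω
≤T⇒⊑ ∧≤lT            = Conf.∧-⊑ˡ
≤T⇒⊑ ∧≤rT            = Conf.∧-⊑ʳ
≤T⇒⊑ dupT            = Conf.⊑-∧-diag
≤T⇒⊑ (∧monoT p q)    = Conf.∧-mono-⊑ (≤T⇒⊑ p) (≤T⇒⊑ q)
≤T⇒⊑ ωT≤⇒            = Conf.ω-⊑-ω⇒ω
≤T⇒⊑ ⇒∧T             = Conf.⇒-∧-⊑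
≤T⇒⊑ (⇒monoT p q)    = Conf.⇒-mono-⊑ p q

mainTheorem18 : (τ : ConfTy) (κ : CompTy) → ¬ (τ ≃T ωT) → ¬ (κ ≃C ωC) →
    ((n : ℕ) (δs : Fin n → ValTy) (τs : Fin n → ConfTy) (δ : ValTy) →
      (⋀D ⊤ (λ i → δs i ⇒D τs i) ≤D δ ⇒D τ)
        ⇔ Σ (Subset n) (λ J → Nonempty J × (δ ≤D ⋀D J δs) × (⋀T J τs ≤T τ)))
    × ((n : ℕ) (σs : Fin n → StoTy) (κs : Fin n → CompTy) (σ : StoTy) →
      (⋀T ⊤ (λ i → σs i ⇒T κs i) ≤T σ ⇒T κ)
        ⇔ Σ (Subset n) (λ J → Nonempty J × (σ ≤S ⋀S J σs) × (⋀C J κs ≤C κ)))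
mainTheorem18 τ κ τ≄ω κ≄ω =
  Val.⋀-arrows≤arrow⇔ ≤D⇒⊑ (λ ωT≤τ → τ≄ω (≤ωT , ωT≤τ)) ,
  Conf.⋀-arrows≤arrow⇔ ≤T⇒⊑ (λ ωC≤κ → κ≄ω (≤ωC , ωC≤κ))
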